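{- Let $\psi$ be an MSO formula over the signature $\{=,\to\}$ that is cw-non-trivial under $\xi=(\forall x,\forall y,\ x\to y)\vee(\forall x,\forall y,\ \neg\,x\to y)$, and let $r$ be the quantifier rank of $\psi$. There exists $N_r\in\mathbb N$ such that either: for every $n>N_r$, $K_n\models\psi$ and $I_n\not\models\psi$; or for every $n>N_r$, $I_n\models\psi$ and $K_n\not\models\psi$.
   Context: Graphs are directed graphs over the binary relation $\to$. $K_n$ denotes the clique on $n$ vertices, i.e. the graph with $x\to y$ for all vertices $x,y$ (including loops); $I_n$ denotes the graph on $n$ vertices with no arcs. Clique-width is the minimum number of colors in a clique-decomposition (single-vertex creation, recoloring, and color-based joins of disjoint unions). $\psi$ is cw-non-trivial under $\xi$ if for some $k$ there are infinitely many graphs of clique-width at most $k$ satisfying $\psi\wedge\xi$ and infinitely many satisfying $\neg\psi\wedge\xi$. -}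

module Defs where

open import Data.Nat using (ℕ; zero; suc; _+_; _≤_; _<_; _⊔_)
open import Data.Fin using (Fin; splitAt)
open import Data.Bool using (Bool; true; false; _∧_)
open import Data.Sum using (_⊎_; inj₁; inj₂)
open import Data.Product using (Σ; ∃; ∃-syntax; _×_; _,_)
open import Data.Empty using (⊥)
open import Relation.Nullary using (¬_)
open import Relation.Binary.PropositionalEquality using (_≡_)

record Graph : Set where
  constructor mkGraph
  field
    size : ℕ
    arc  : Fin size → Fin size → Bool
open Graph public

K : ℕ → Graph
K n = mkGraph n (λ _ _ → true)

I : ℕ → Graph
I n = mkGraph n (λ _ _ → false)

record _≅_ (G H : Graph) : Set where
  field
    to      : Fin (size G) → Fin (size H)
    from    : Fin (size H) → Fin (size G)
    from-to : ∀ x → from (to x) ≡ x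
    to-from : ∀ y → to (from y) ≡ y
    pres    : ∀ x y → arc G x y ≡ arc H (to x) (to y)

-- MSO formulas over the signature {=, →}, well-scoped:
-- m first-order variables, s (monadic) second-order variables in scope.

data Form : ℕ → ℕ → Set where
  eqF  : ∀ {m s} → Fin m → Fin m → Form m s
  arcF : ∀ {m s} → Fin m → Fin m → Form m s
  memF : ∀ {m s} → Fin m → Fin s → Form m s
  ¬F   : ∀ {m s} → Form m s → Form m s
  _∧F_ : ∀ {m s} → Form m s → Form m s → Form m s
  _∨F_ : ∀ {m s} → Form m s → Form m s → Form m s
  ∃₁   : ∀ {m s} → Form (suc m) s → Form m s
  ∀₁   : ∀ {m s} → Form (suc m) s → Form m s
  ∃₂   : ∀ {m s} → Form m (suc s) → Form m s
  ∀₂   : ∀ {m s} → Form m (suc s) → Form m s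

Sentence : Set
Sentence = Form 0 0

qr : ∀ {m s} → Form m s → ℕ
qr (eqF _ _)  = 0
qr (arcF _ _) = 0
qr (memF _ _) = 0
qr (¬F φ)     = qr φ
qr (φ ∧F χ)   = qr φ ⊔ qr χ
qr (φ ∨F χ)   = qr φ ⊔ qr χ
qr (∃₁ φ)     = suc (qr φ)
qr (∀₁ φ)     = suc (qr φ)
qr (∃₂ φ)     = suc (qr φ)
qr (∀₂ φ)     = suc (qr φ)

ext : ∀ {m} {A : Set} → (Fin m → A) → A → Fin (suc m) → A
ext ρ a Fin.zero    = a
ext ρ a (Fin.suc i) = ρ i

Sat : (G : Graph) → ∀ {m s} → (Fin m → Fin (size G)) →
      (Fin s → (Fin (size G) → Bool)) → Form m s → Set
Sat G ρ σ (eqF i j)  = ρ i ≡ ρ j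
Sat G ρ σ (arcF i j) = arc G (ρ i) (ρ j) ≡ true
Sat G ρ σ (memF i X) = σ X (ρ i) ≡ true
Sat G ρ σ (¬F φ)     = ¬ Sat G ρ σ φ
Sat G ρ σ (φ ∧F χ)   = Sat G ρ σ φ × Sat G ρ σ χ
Sat G ρ σ (φ ∨F χ)   = Sat G ρ σ φ ⊎ Sat G ρ σ χ
Sat G ρ σ (∃₁ φ)     = Σ (Fin (size G)) λ v → Sat G (ext ρ v) σ φ
Sat G ρ σ (∀₁ φ)     = (v : Fin (size G)) → Sat G (ext ρ v) σ φ
Sat G ρ σ (∃₂ φ)     = Σ (Fin (size G) → Bool) λ X → Sat G ρ (ext σ X) φ
Sat G ρ σ (∀₂ φ)     = (X : Fin (size G) → Bool) → Sat G ρ (ext σ X) φ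

noVar : ∀ {A : Set} → Fin 0 → A
noVar ()

_⊨_ : Graph → Sentence → Set
G ⊨ ψ = Sat G noVar noVar ψ

ξ : Sentence
ξ = ∀₁ (∀₁ (arcF (Fin.suc Fin.zero) Fin.zero))
    ∨F ∀₁ (∀₁ (¬F (arcF (Fin.suc Fin.zero) Fin.zero)))

-- Terms: create a single vertex of colour c (with or without a loop),
-- recolour by an arbitrary map on colours, and join two disjoint terms:
-- disjoint union plus all arcs x → y with x on the left of colour a and
-- y on the right of colour b whenever L a b = true, and all arcs
-- y → x (y right, colour b; x left, colour a) whenever R b a = true.

data CWTerm (k : ℕ) : Set where
  vtx   : Fin k → Bool → CWTerm k
  recol : (Fin k → Fin k) → CWTerm k → CWTerm k
  join  : (Fin k → Fin k → Bool) → (Fin k → Fin k → Bool) →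
          CWTerm k → CWTerm k → CWTerm k

tsize : ∀ {k} → CWTerm k → ℕ
tsize (vtx _ _)      = 1
tsize (recol _ t)    = tsize t
tsize (join _ _ s t) = tsize s + tsize t

colour : ∀ {k} (t : CWTerm k) → Fin (tsize t) → Fin k
colour (vtx c _) _        = c
colour (recol f t) x      = f (colour t x)
colour (join _ _ s t) x with splitAt (tsize s) x
... | inj₁ u = colour s u
... | inj₂ v = colour t v

tarc : ∀ {k} (t : CWTerm k) → Fin (tsize t) → Fin (tsize t) → Bool
tarc (vtx _ l) _ _ = l
tarc (recol _ t) x y = tarc t x y
tarc (join L R s t) x y with splitAt (tsize s) x | splitAt (tsize s) y
... | inj₁ u | inj₁ u' = tarc s u u'
... | inj₂ v | inj₂ v' = tarc t v v'
... | inj₁ u | inj₂ v  = L (colour s u) (colour t v)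
... | inj₂ v | inj₁ u  = R (colour t v) (colour s u)

⟦_⟧ : ∀ {k} → CWTerm k → Graph
⟦ t ⟧ = mkGraph (tsize t) (tarc t)

CW≤ : ℕ → Graph → Set
CW≤ k G = Σ (CWTerm k) λ t → ⟦ t ⟧ ≅ G

-- "infinitely many graphs (up to isomorphism) of clique-width ≤ k
--  satisfying φ" : there are such graphs of arbitrarily large size
-- (there are only finitely many graphs of each size up to iso).
InfManyCW : ℕ → (Graph → Set) → Set
InfManyCW k P = ∀ m → Σ Graph λ G → m ≤ size G × CW≤ k G × P G

CwNonTrivial : Sentence → Sentence → Set
CwNonTrivial ψ χ = ∃[ k ] (InfManyCW k (λ G → G ⊨ ψ × G ⊨ χ)
                          × InfManyCW k (λ G → ¬ (G ⊨ ψ) × G ⊨ χ))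

-- A graph satisfying ξ has a constant arc relation, so it is described by its size and one
-- bit.  Two such graphs with the same bit and at least 2^r vertices satisfy the same MSO
-- sentences of quantifier rank r, by an Ehrenfeucht–Fraïssé argument: label each vertex by
-- its answers to the moves played so far (is it the chosen vertex? is it in the chosen set?)
-- and keep every label class equally large on both sides, or at least 2^(rounds left) large
-- on both.  A vertex move removes one vertex from a class, and a set move splits each class
-- in two, which is possible because a class size of at least 2t splits into two parts each
-- equal to or at least t.  A cw-non-trivial ψ has a model and a non-model of ξ with at least
-- 2^r vertices; they cannot have the same bit, so ψ holds on all large cliques and on no
-- large edgeless graph, or the other way round.
module Submission where

open import Defs
open import Data.Nat using (ℕ; _<_)
open import Data.Product using (∃-syntax; _×_)
open import Data.Sum using (_⊎_)
open import Relation.Nullary using (¬_)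
open import Relation.Binary.PropositionalEquality using (_≡_)

open import Data.Nat using (zero; suc; _+_; _∸_; _^_; _≤_; z≤n; s≤s; _≤?_)
open import Data.Nat.Properties
  using (≤-refl; ≤-reflexive; ≤-trans; <⇒≤; ≰⇒>; m≤m+n; m≤n+m; +-comm; +-suc; +-identityʳ;
         +-cancelˡ-≡; +-cancelˡ-≤; +-monoˡ-≤; m+[n∸m]≡n; m⊔n≤o⇒m≤o; m⊔n≤o⇒n≤o; m^n>0)
open import Data.Fin using (Fin; zero; suc)
open import Data.Fin.Properties using (_≟_)
open import Data.Bool using (Bool; true; false; _∧_; if_then_else_)
open import Data.Bool.Properties using (∧-zeroʳ; ¬-not) renaming (_≟_ to _≟ᵇ_)
open import Data.Vec using (Vec; []; _∷_)
open import Data.Vec.Properties using (∷-injectiveˡ; ∷-injectiveʳ) renaming (≡-dec to Vec-≡-dec)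
open import Data.Product using (Σ; _,_; proj₁; proj₂)
open import Data.Sum using (inj₁; inj₂)
open import Function using (_∘_)
open import Relation.Nullary using (Dec; yes; no; does; contradiction)
open import Relation.Nullary.Decidable using (dec-true)
open import Relation.Binary.Definitions using (DecidableEquality)
open import Relation.Binary.PropositionalEquality using (refl; sym; trans; cong; subst; subst₂)

does-true⇒ : ∀ {A : Set} (a? : Dec A) → does a? ≡ true → A
does-true⇒ (yes a) _ = a

count : ∀ {n} → (Fin n → Bool) → ℕ
count {zero}  p = 0
count {suc n} p = (if p zero then 1 else 0) + count (p ∘ suc)

count-cong : ∀ {n} {p q : Fin n → Bool} → (∀ u → p u ≡ q u) → count p ≡ count q
count-cong {zero}  eq = refl
count-cong {suc n} eq rewrite eq zero = cong (_ +_) (count-cong (eq ∘ suc))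

count-true : ∀ n → count {n} (λ _ → true) ≡ n
count-true zero    = refl
count-true (suc n) = cong suc (count-true n)

count-false : ∀ n → count {n} (λ _ → false) ≡ 0
count-false zero    = refl
count-false (suc n) = count-false n

count-witness : ∀ {n} (p : Fin n → Bool) v → p v ≡ true → 0 < count p
count-witness p zero    pv rewrite pv = s≤s z≤n
count-witness p (suc v) pv = ≤-trans (count-witness (p ∘ suc) v pv) (m≤n+m _ _)

count-pos : ∀ {n} (p : Fin n → Bool) → 0 < count p → ∃[ u ] p u ≡ true
count-pos {suc n} p pos with p zero in pzero
... | true  = zero , pzero
... | false = let u , pu = count-pos (p ∘ suc) pos in suc u , pu

count-fibres : ∀ {n} (B p : Fin n → Bool) →
               count (λ u → does (B u ≟ᵇ true) ∧ p u) + count (λ u → does (B u ≟ᵇ false) ∧ p u)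
               ≡ count p
count-fibres {zero}  B p = refl
count-fibres {suc n} B p with B zero | p zero | count-fibres (B ∘ suc) (p ∘ suc)
... | true  | true  | ih = cong suc ih
... | true  | false | ih = ih
... | false | true  | ih = trans (+-suc _ _) (cong suc ih)
... | false | false | ih = ih

count-single : ∀ {n} (v : Fin n) (p : Fin n → Bool) →
               count (λ u → does (does (v ≟ u) ≟ᵇ true) ∧ p u) ≡ (if p v then 1 else 0)
count-single {suc n} zero p =
  trans (cong ((if p zero then 1 else 0) +_) (count-false n)) (+-identityʳ _)
count-single (suc v) p = count-single v (p ∘ suc)

count-restrict : ∀ {n} {f g : Fin n → Bool} (p : Fin n → Bool) → (∀ u → p u ≡ true → f u ≡ g u) →
                 count (λ u → f u ∧ p u) ≡ count (λ u → g u ∧ p u)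
count-restrict {f = f} {g} p f≗g = count-cong pointwise
  where
  pointwise : ∀ u → f u ∧ p u ≡ g u ∧ p u
  pointwise u with p u in pu
  ... | true  = cong (_∧ true) (f≗g u pu)
  ... | false = trans (∧-zeroʳ (f u)) (sym (∧-zeroʳ (g u)))

count-choose : ∀ {n} (p : Fin n → Bool) k → k ≤ count p →
               Σ (Fin n → Bool) λ X → count (λ u → does (X u ≟ᵇ true) ∧ p u) ≡ k
count-choose {zero} p zero z≤n = (λ ()) , refl
count-choose {suc n} p k k≤ with p zero
count-choose {suc n} p (suc k) (s≤s k≤) | true =
  let X , size = count-choose (p ∘ suc) k k≤ in ext X true , cong suc size
count-choose {suc n} p zero    z≤n      | true =
  let X , size = count-choose (p ∘ suc) zero z≤n in ext X false , size
... | false =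
  let X , size = count-choose (p ∘ suc) k k≤ in ext X false , size

infix 4 _≃[_]_

_≃[_]_ : ℕ → ℕ → ℕ → Set
p ≃[ t ] q = p ≡ q ⊎ (t ≤ p × t ≤ q)

≃-sym : ∀ {t p q} → p ≃[ t ] q → q ≃[ t ] p
≃-sym (inj₁ p≡q)         = inj₁ (sym p≡q)
≃-sym (inj₂ (t≤p , t≤q)) = inj₂ (t≤q , t≤p)

≃-pos : ∀ {t p q} → 0 < t → p ≃[ t ] q → 0 < p → 0 < q
≃-pos t>0 (inj₁ refl)      p>0 = p>0
≃-pos t>0 (inj₂ (_ , t≤q)) _   = ≤-trans t>0 t≤q

m+m≤n+o⇒n≤m⇒m≤o : ∀ {m n o} → m + m ≤ n + o → n ≤ m → m ≤ o
m+m≤n+o⇒n≤m⇒m≤o {m} {n} {o} le n≤m = +-cancelˡ-≤ m m o (≤-trans le (+-monoˡ-≤ o n≤m))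

≃-cancelˡ : ∀ {t e a b} → e ≤ t → e + a ≃[ t + t ] e + b → a ≃[ t ] b
≃-cancelˡ {e = e} e≤t (inj₁ eq) = inj₁ (+-cancelˡ-≡ e _ _ eq)
≃-cancelˡ e≤t (inj₂ (le , le′)) =
  inj₂ (m+m≤n+o⇒n≤m⇒m≤o le e≤t , m+m≤n+o⇒n≤m⇒m≤o le′ e≤t)

m+m≤n⇒o≤m⇒m≤n∸o : ∀ {m n o} → m + m ≤ n → o ≤ m → m ≤ n ∸ o
m+m≤n⇒o≤m⇒m≤n∸o {m} {n} {o} le o≤m =
  m+m≤n+o⇒n≤m⇒m≤o (subst (m + m ≤_) (sym (m+[n∸m]≡n o≤n)) le) o≤m
  where
  o≤n : o ≤ n
  o≤n = ≤-trans o≤m (≤-trans (m≤m+n m m) le)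

record Splitting (t p₁ p₂ q : ℕ) : Set where
  constructor splitting
  field
    q₁ q₂   : ℕ
    q₁+q₂≡q : q₁ + q₂ ≡ q
    p₁≃q₁   : p₁ ≃[ t ] q₁
    p₂≃q₂   : p₂ ≃[ t ] q₂
open Splitting

≃-split : ∀ {t} p₁ p₂ {q} → p₁ + p₂ ≃[ t + t ] q → Splitting t p₁ p₂ q
≃-split p₁ p₂ (inj₁ refl) = splitting p₁ p₂ refl (inj₁ refl) (inj₁ refl)
≃-split {t} p₁ p₂ {q} (inj₂ (p-large , q-large)) with p₁ ≤? t | p₂ ≤? t
... | yes p₁≤t | _ =
  splitting p₁ (q ∸ p₁) (m+[n∸m]≡n (≤-trans p₁≤t t≤q)) (inj₁ refl)
    (inj₂ (m+m≤n+o⇒n≤m⇒m≤o p-large p₁≤t , m+m≤n⇒o≤m⇒m≤n∸o q-large p₁≤t))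
  where
  t≤q : t ≤ q
  t≤q = ≤-trans (m≤m+n t t) q-large
... | no _ | yes p₂≤t =
  splitting (q ∸ p₂) p₂ (trans (+-comm (q ∸ p₂) p₂) (m+[n∸m]≡n (≤-trans p₂≤t t≤q)))
    (inj₂ (m+m≤n+o⇒n≤m⇒m≤o (subst (t + t ≤_) (+-comm p₁ p₂) p-large) p₂≤t , m+m≤n⇒o≤m⇒m≤n∸o q-large p₂≤t))
    (inj₁ refl)
  where
  t≤q : t ≤ q
  t≤q = ≤-trans (m≤m+n t t) q-large
... | no p₁≰t | no p₂≰t =
  splitting t (q ∸ t) (m+[n∸m]≡n (≤-trans (m≤m+n t t) q-large))
    (inj₂ (<⇒≤ (≰⇒> p₁≰t) , ≤-refl)) (inj₂ (<⇒≤ (≰⇒> p₂≰t) , m+m≤n⇒o≤m⇒m≤n∸o q-large ≤-refl))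

record Position (n m s k : ℕ) : Set where
  constructor position
  field
    names  : Fin m → Fin n
    sets   : Fin s → Fin n → Bool
    label  : Fin n → Vec Bool k
open Position

_≟ᶜ_ : ∀ {k} → DecidableEquality (Vec Bool k)
_≟ᶜ_ = Vec-≡-dec _≟ᵇ_

classSize : ∀ {n k} → (Fin n → Vec Bool k) → Vec Bool k → ℕ
classSize κ c = count (λ u → does (κ u ≟ᶜ c))

classSize-refine : ∀ {n k} (B : Fin n → Bool) (κ : Fin n → Vec Bool k) c →
                   classSize (λ u → B u ∷ κ u) (true ∷ c) + classSize (λ u → B u ∷ κ u) (false ∷ c)
                   ≡ classSize κ c
classSize-refine B κ c = count-fibres B (λ u → does (κ u ≟ᶜ c))

start : ∀ n → Position n 0 0 0
start n = position noVar noVar (λ _ → [])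

assignVertex : ∀ {n m s k} → Position n m s k → Fin n → Position n (suc m) s (suc k)
assignVertex P v = position (ext (names P) v) (sets P) (λ u → does (v ≟ u) ∷ label P u)

assignSet : ∀ {n m s k} → Position n m s k → (Fin n → Bool) → Position n m (suc s) (suc k)
assignSet P X = position (names P) (ext (sets P) X) (λ u → X u ∷ label P u)

record Similar {n n′ m s k} (t : ℕ) (P : Position n m s k) (P′ : Position n′ m s k) : Set where
  field
    names-agree : ∀ {u u′} → label P u ≡ label P′ u′ →
                  ∀ j → does (names P j ≟ u) ≡ does (names P′ j ≟ u′)
    sets-agree  : ∀ {u u′} → label P u ≡ label P′ u′ → ∀ X → sets P X u ≡ sets P′ X u′
    classes     : ∀ c → classSize (label P) c ≃[ t ] classSize (label P′) c
open Similar

Similar-sym : ∀ {n n′ m s k t} {P : Position n m s k} {P′ : Position n′ m s k} →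
              Similar t P P′ → Similar t P′ P
Similar-sym S = record
  { names-agree = λ eq j → sym (names-agree S (sym eq) j)
  ; sets-agree  = λ eq X → sym (sets-agree S (sym eq) X)
  ; classes     = ≃-sym ∘ classes S
  }

Similar-start : ∀ {t n n′} → t ≤ n → t ≤ n′ → Similar t (start n) (start n′)
Similar-start {t} {n} {n′} t≤n t≤n′ = record
  { names-agree = λ _ ()
  ; sets-agree  = λ _ ()
  ; classes     = λ { [] → inj₂ (subst (t ≤_) (sym (count-true n)) t≤n ,
                                 subst (t ≤_) (sym (count-true n′)) t≤n′) }
  }

Similar-witness : ∀ {n n′ m s k t} {P : Position n m s k} {P′ : Position n′ m s k} →
                  0 < t → Similar t P P′ → ∀ u → ∃[ u′ ] label P′ u′ ≡ label P u
Similar-witness {P = P} {P′} t>0 S u =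
  let u′ , same = count-pos _ (≃-pos t>0 (classes S (label P u))
                                     (count-witness _ u (dec-true (label P u ≟ᶜ label P u) refl)))
  in u′ , does-true⇒ (label P′ u′ ≟ᶜ label P u) same

Similar-named : ∀ {n n′ m s k t} {P : Position n m s k} {P′ : Position n′ m s k} →
                0 < t → Similar t P P′ → ∀ i → label P (names P i) ≡ label P′ (names P′ i)
Similar-named {P = P} {P′} t>0 S i with Similar-witness t>0 S (names P i)
... | w , same = sym (trans (cong (label P′) names′-i≡w) same)
  where
  names′-i≡w : names P′ i ≡ w
  names′-i≡w = does-true⇒ (names P′ i ≟ w)
    (trans (sym (names-agree S (sym same) i)) (dec-true (names P i ≟ names P i) refl))

forth-vertex : ∀ {n n′ m s k t} {P : Position n m s k} {P′ : Position n′ m s k} →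
               0 < t → Similar (t + t) P P′ → ∀ v →
               ∃[ w ] Similar t (assignVertex P v) (assignVertex P′ w)
forth-vertex {n′ = n′} {m} {s} {k} {t} {P} {P′} t>0 S v = w , record
  { names-agree = names-agree′
  ; sets-agree  = λ eq → sets-agree S (∷-injectiveʳ eq)
  ; classes     = classes′
  }
  where
  w-found : ∃[ w ] label P′ w ≡ label P v
  w-found = Similar-witness (≤-trans t>0 (m≤m+n t t)) S v
  w : Fin n′
  w = proj₁ w-found

  names-agree′ : ∀ {u u′} → label (assignVertex P v) u ≡ label (assignVertex P′ w) u′ →
                 ∀ j → does (ext (names P) v j ≟ u) ≡ does (ext (names P′) w j ≟ u′)
  names-agree′ eq zero    = ∷-injectiveˡ eq
  names-agree′ eq (suc j) = names-agree S (∷-injectiveʳ eq) j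

  chosen : ∀ c → ℕ
  chosen c = if does (label P v ≟ᶜ c) then 1 else 0

  chosen≤t : ∀ c → chosen c ≤ t
  chosen≤t c with does (label P v ≟ᶜ c)
  ... | true  = t>0
  ... | false = z≤n

  marked-class : ∀ {n″} (Q : Position n″ m s k) x → label Q x ≡ label P v → ∀ c →
                 classSize (label (assignVertex Q x)) (true ∷ c) ≡ chosen c
  marked-class Q x same c =
    trans (count-single x (λ u → does (label Q u ≟ᶜ c)))
          (cong (λ l → if does (l ≟ᶜ c) then 1 else 0) same)

  unmarked-class : ∀ {n″} (Q : Position n″ m s k) x → label Q x ≡ label P v → ∀ c →
                   chosen c + classSize (label (assignVertex Q x)) (false ∷ c) ≡ classSize (label Q) c
  unmarked-class Q x same c =
    trans (cong (_+ classSize (label (assignVertex Q x)) (false ∷ c)) (sym (marked-class Q x same c)))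
          (classSize-refine (λ u → does (x ≟ u)) (label Q) c)

  classes′ : ∀ c → classSize (label (assignVertex P v)) c ≃[ t ] classSize (label (assignVertex P′ w)) c
  classes′ (true ∷ c)  = inj₁ (trans (marked-class P v refl c) (sym (marked-class P′ w (proj₂ w-found) c)))
  classes′ (false ∷ c) =
    ≃-cancelˡ (chosen≤t c)
      (subst₂ (_≃[ t + t ]_) (sym (unmarked-class P v refl c)) (sym (unmarked-class P′ w (proj₂ w-found) c))
              (classes S c))

forth-set : ∀ {n n′ m s k t} {P : Position n m s k} {P′ : Position n′ m s k} →
            Similar (t + t) P P′ → ∀ X →
            Σ (Fin n′ → Bool) λ X′ → Similar t (assignSet P X) (assignSet P′ X′)
forth-set {n′ = n′} {t = t} {P} {P′} S X = X′ , record
  { names-agree = λ eq → names-agree S (∷-injectiveʳ eq)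
  ; sets-agree  = sets-agree′
  ; classes     = classes′
  }
  where
  inside outside : ∀ c → ℕ
  inside c  = classSize (label (assignSet P X)) (true ∷ c)
  outside c = classSize (label (assignSet P X)) (false ∷ c)

  split : ∀ c → Splitting t (inside c) (outside c) (classSize (label P′) c)
  split c = ≃-split (inside c) (outside c)
              (subst (_≃[ t + t ] _) (sym (classSize-refine X (label P) c)) (classes S c))

  choice : ∀ c → Σ (Fin n′ → Bool) λ Y →
             count (λ u → does (Y u ≟ᵇ true) ∧ does (label P′ u ≟ᶜ c)) ≡ q₁ (split c)
  choice c = count-choose (λ u → does (label P′ u ≟ᶜ c)) (q₁ (split c))
               (subst (q₁ (split c) ≤_) (q₁+q₂≡q (split c)) (m≤m+n _ _))
  X′ : Fin n′ → Bool
  X′ u = proj₁ (choice (label P′ u)) u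

  inside′ : ∀ c → classSize (label (assignSet P′ X′)) (true ∷ c) ≡ q₁ (split c)
  inside′ c = trans (count-restrict _ agrees) (proj₂ (choice c))
    where
    agrees : ∀ u → does (label P′ u ≟ᶜ c) ≡ true →
             does (X′ u ≟ᵇ true) ≡ does (proj₁ (choice c) u ≟ᵇ true)
    agrees u same = cong (λ l → does (proj₁ (choice l) u ≟ᵇ true)) (does-true⇒ (label P′ u ≟ᶜ c) same)

  outside′ : ∀ c → classSize (label (assignSet P′ X′)) (false ∷ c) ≡ q₂ (split c)
  outside′ c = +-cancelˡ-≡ (q₁ (split c)) _ _
    (trans (cong (_+ classSize (label (assignSet P′ X′)) (false ∷ c)) (sym (inside′ c)))
      (trans (classSize-refine X′ (label P′) c) (sym (q₁+q₂≡q (split c)))))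

  sets-agree′ : ∀ {u u′} → label (assignSet P X) u ≡ label (assignSet P′ X′) u′ →
                ∀ Y → ext (sets P) X Y u ≡ ext (sets P′) X′ Y u′
  sets-agree′ eq zero    = ∷-injectiveˡ eq
  sets-agree′ eq (suc Y) = sets-agree S (∷-injectiveʳ eq) Y

  classes′ : ∀ c → classSize (label (assignSet P X)) c ≃[ t ] classSize (label (assignSet P′ X′)) c
  classes′ (true ∷ c)  = subst (inside c ≃[ t ]_) (sym (inside′ c)) (p₁≃q₁ (split c))
  classes′ (false ∷ c) = subst (outside c ≃[ t ]_) (sym (outside′ c)) (p₂≃q₂ (split c))

Constant : Bool → Graph → Set
Constant b G = ∀ x y → arc G x y ≡ b

constantGraph : Bool → ℕ → Graph
constantGraph b n = mkGraph n (λ _ _ → b)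

Similar-halve : ∀ {n n′ m s k} r {P : Position n m s k} {P′ : Position n′ m s k} →
                Similar (2 ^ suc r) P P′ → Similar (2 ^ r + 2 ^ r) P P′
Similar-halve r {P} {P′} = subst (λ t → Similar t P P′) (cong (2 ^ r +_) (+-identityʳ (2 ^ r)))

transfer : ∀ {b G G′} → Constant b G → Constant b G′ →
           ∀ {m s k r} (φ : Form m s) → qr φ ≤ r →
           {P : Position (size G) m s k} {P′ : Position (size G′) m s k} → Similar (2 ^ r) P P′ →
           Sat G (names P) (sets P) φ → Sat G′ (names P′) (sets P′) φ
transfer c c′ {r = r} (eqF i j) _ {P} {P′} S eq =
  sym (does-true⇒ (names P′ j ≟ names P′ i)
        (trans (sym (names-agree S (Similar-named (m^n>0 2 r) S i) j)) (dec-true (names P j ≟ names P i) (sym eq))))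
transfer c c′ (arcF i j) _ S arc≡true = trans (c′ _ _) (trans (sym (c _ _)) arc≡true)
transfer c c′ {r = r} (memF i X) _ S mem = trans (sym (sets-agree S (Similar-named (m^n>0 2 r) S i) X)) mem
transfer c c′ (¬F φ) le S ¬sat = ¬sat ∘ transfer c′ c φ le (Similar-sym S)
transfer c c′ (φ ∧F χ) le S (sat-φ , sat-χ) =
  transfer c c′ φ (m⊔n≤o⇒m≤o _ _ le) S sat-φ , transfer c c′ χ (m⊔n≤o⇒n≤o _ _ le) S sat-χ
transfer c c′ (φ ∨F χ) le S (inj₁ sat) = inj₁ (transfer c c′ φ (m⊔n≤o⇒m≤o _ _ le) S sat)
transfer c c′ (φ ∨F χ) le S (inj₂ sat) = inj₂ (transfer c c′ χ (m⊔n≤o⇒n≤o _ _ le) S sat)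
transfer c c′ {r = suc r} (∃₁ φ) (s≤s le) S (v , sat) =
  let w , S′ = forth-vertex (m^n>0 2 r) (Similar-halve r S) v
  in w , transfer c c′ φ le S′ sat
transfer c c′ {r = suc r} (∀₁ φ) (s≤s le) S sat w =
  let v , S′ = forth-vertex (m^n>0 2 r) (Similar-halve r (Similar-sym S)) w
  in transfer c c′ φ le (Similar-sym S′) (sat v)
transfer c c′ {r = suc r} (∃₂ φ) (s≤s le) S (X , sat) =
  let X′ , S′ = forth-set (Similar-halve r S) X
  in X′ , transfer c c′ φ le S′ sat
transfer c c′ {r = suc r} (∀₂ φ) (s≤s le) S sat X′ =
  let X , S′ = forth-set (Similar-halve r (Similar-sym S)) X′
  in transfer c c′ φ le (Similar-sym S′) (sat X)

constant-⊨-transfer : ∀ {b r G G′} (ψ : Sentence) → qr ψ ≤ r →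
                      Constant b G → 2 ^ r ≤ size G → Constant b G′ → 2 ^ r ≤ size G′ →
                      G ⊨ ψ → G′ ⊨ ψ
constant-⊨-transfer ψ le c large c′ large′ = transfer c c′ ψ le (Similar-start large large′)

ξ⇒constant : ∀ {G} → G ⊨ ξ → ∃[ b ] Constant b G
ξ⇒constant (inj₁ all-arcs) = true , all-arcs
ξ⇒constant (inj₂ no-arcs)  = false , λ x y → ¬-not (no-arcs x y)

separated : ∀ {r b₁ b₂ G₁ G₂} (ψ : Sentence) → qr ψ ≤ r →
            Constant b₁ G₁ → 2 ^ r ≤ size G₁ → G₁ ⊨ ψ →
            Constant b₂ G₂ → 2 ^ r ≤ size G₂ → ¬ (G₂ ⊨ ψ) →
            ∀ n → 2 ^ r ≤ n → (constantGraph b₁ n ⊨ ψ) × ¬ (constantGraph b₂ n ⊨ ψ)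
separated ψ le c₁ large₁ sat₁ c₂ large₂ unsat₂ n large =
  constant-⊨-transfer ψ le c₁ large₁ (λ _ _ → refl) large sat₁ ,
  unsat₂ ∘ constant-⊨-transfer ψ le (λ _ _ → refl) large c₂ large₂

K-or-I : ∀ N ψ b₁ b₂ → (∀ n → N < n → (constantGraph b₁ n ⊨ ψ) × ¬ (constantGraph b₂ n ⊨ ψ)) →
         (∀ n → N < n → (K n ⊨ ψ) × ¬ (I n ⊨ ψ)) ⊎ (∀ n → N < n → (I n ⊨ ψ) × ¬ (K n ⊨ ψ))
K-or-I N ψ true  false sep = inj₁ sep
K-or-I N ψ false true  sep = inj₂ sep
K-or-I N ψ true  true  sep = let sat , unsat = sep (suc N) ≤-refl in contradiction sat unsat
K-or-I N ψ false false sep = let sat , unsat = sep (suc N) ≤-refl in contradiction sat unsat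

lemma20 : (r : ℕ) → ∃[ N ] ((ψ : Sentence) → qr ψ ≡ r → CwNonTrivial ψ ξ →
            ((∀ n → N < n → (K n ⊨ ψ) × ¬ (I n ⊨ ψ))
             ⊎ (∀ n → N < n → (I n ⊨ ψ) × ¬ (K n ⊨ ψ))))
lemma20 r = 2 ^ r , decided
  where
  decided : (ψ : Sentence) → qr ψ ≡ r → CwNonTrivial ψ ξ →
            ((∀ n → 2 ^ r < n → (K n ⊨ ψ) × ¬ (I n ⊨ ψ))
             ⊎ (∀ n → 2 ^ r < n → (I n ⊨ ψ) × ¬ (K n ⊨ ψ)))
  decided ψ qr≡r (_ , models , non-models)
    with models (2 ^ r) | non-models (2 ^ r)
  ... | G₁ , large₁ , _ , sat₁ , ξ₁ | G₂ , large₂ , _ , unsat₂ , ξ₂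
    with ξ⇒constant ξ₁ | ξ⇒constant ξ₂
  ... | b₁ , c₁ | b₂ , c₂ =
    K-or-I (2 ^ r) ψ b₁ b₂ λ n r<n →
      separated ψ (≤-reflexive qr≡r) c₁ large₁ sat₁ c₂ large₂ unsat₂ n (<⇒≤ r<n)
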